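{- Let $z$ be an uncritical vertex in a finite simple graph $G$. Then $Z(G\setminus z)=Z(G)$.
   Context: Zero forcing rule: a filled vertex $v$ forces an unfilled vertex $u$ if $u$ is the only unfilled neighbor of $v$; each vertex forces at most once. A zero forcing set is an initially filled set from which repeated forcing fills all vertices; $Z(G)$ is the minimum size of a zero forcing set, and a zero forcing set of that size is optimal. A complete forcing sequence from $F$ is a sequence of valid forces after which no further forces are possible; an optimal forcing sequence is a complete forcing sequence from an optimal zero forcing set. A forcing sequence yields forcing chains: maximal sequences $(v_0,\dots,v_\ell)$ with $v_{i-1}\to v_i$ a force in the sequence; for $\ell\ge1$, $v_0$ is the source vertex and $v_\ell$ the terminal vertex of the chain (chains of length $0$ have neither). A vertex is uncritical if, for every optimal forcing sequence, it is the source or the terminal vertex of the chain containing it. $G\setminus z$ denotes $G$ with vertex $z$ deleted. -}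

module Defs where

open import Data.Nat using (ℕ; suc; _≤_)
open import Data.Bool using (Bool; true; false)
open import Data.Fin using (Fin; punchIn)
open import Data.Fin.Subset using (Subset; _∈_; _∉_; _∪_; ⁅_⁆; ∣_∣)
open import Data.List using (List; []; _∷_)
open import Data.Product using (Σ; _×_; _,_)
open import Data.Sum using (_⊎_)
open import Relation.Binary.PropositionalEquality using (_≡_; _≢_)
open import Relation.Nullary using (¬_)
import Data.List.Membership.Propositional as LM

record Graph (n : ℕ) : Set where
  field
    adj    : Fin n → Fin n → Bool
    adj-sym    : ∀ u v → adj u v ≡ adj v u
    adj-irrefl : ∀ v → adj v v ≡ false
open Graph public

-- G ∖ z : delete vertex z; the remaining vertices are renumbered via punchIn z.
_∖_ : ∀ {n} → Graph (suc n) → Fin (suc n) → Graph n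
adj        (G ∖ z) u v = adj G (punchIn z u) (punchIn z v)
adj-sym    (G ∖ z) u v = adj-sym G (punchIn z u) (punchIn z v)
adj-irrefl (G ∖ z) v   = adj-irrefl G (punchIn z v)

-- A force v → u is recorded as the pair (v , u).
Force : ℕ → Set
Force n = Fin n × Fin n

-- Force v → u is valid when the filled set is S and the vertices in `used`
-- have already forced: v filled, v has not forced before, and u is the only
-- unfilled neighbour of v.
ValidForce : ∀ {n} → Graph n → Subset n → List (Fin n) → Fin n → Fin n → Set
ValidForce G S used v u =
  v ∈ S × ¬ (v LM.∈ used) × adj G v u ≡ true × u ∉ S ×
  (∀ w → adj G v w ≡ true → w ≢ u → w ∈ S)

after : ∀ {n} → Subset n → List (Force n) → Subset n
after S []             = S
after S ((v , u) ∷ fs) = after (S ∪ ⁅ u ⁆) fs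

usedAfter : ∀ {n} → List (Fin n) → List (Force n) → List (Fin n)
usedAfter used []             = used
usedAfter used ((v , u) ∷ fs) = usedAfter (v ∷ used) fs

data ValidSeq {n} (G : Graph n) : Subset n → List (Fin n) → List (Force n) → Set where
  []  : ∀ {S used} → ValidSeq G S used []
  _∷_ : ∀ {S used v u fs} → ValidForce G S used v u →
        ValidSeq G (S ∪ ⁅ u ⁆) (v ∷ used) fs →
        ValidSeq G S used ((v , u) ∷ fs)

CompleteSeq : ∀ {n} → Graph n → Subset n → List (Force n) → Set
CompleteSeq G F fs =
  ValidSeq G F [] fs ×
  (∀ v u → ¬ ValidForce G (after F fs) (usedAfter [] fs) v u)

ZeroForcingSet : ∀ {n} → Graph n → Subset n → Set
ZeroForcingSet G F =
  Σ (List (Force _)) λ fs → ValidSeq G F [] fs × (∀ v → v ∈ after F fs)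

IsZ : ∀ {n} → Graph n → ℕ → Set
IsZ G k =
  (Σ (Subset _) λ F → ZeroForcingSet G F × ∣ F ∣ ≡ k) ×
  (∀ F → ZeroForcingSet G F → k ≤ ∣ F ∣)

OptimalZFS : ∀ {n} → Graph n → Subset n → Set
OptimalZFS G F = ZeroForcingSet G F × IsZ G ∣ F ∣

OptimalSeq : ∀ {n} → Graph n → Subset n → List (Force n) → Set
OptimalSeq G F fs = OptimalZFS G F × CompleteSeq G F fs

-- Path v (v₁ ∷ … ∷ vₗ) fs : v → v₁ → … → vₗ are all forces in fs.
data Path {n} (fs : List (Force n)) : Fin n → List (Fin n) → Set where
  end  : ∀ {v} → Path fs v []
  step : ∀ {v u us} → (v , u) LM.∈ fs → Path fs u us → Path fs v (u ∷ us)

lastOf : ∀ {n} → Fin n → List (Fin n) → Fin n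
lastOf v []       = v
lastOf v (u ∷ us) = lastOf u us

IsChain : ∀ {n} → List (Force n) → Fin n → List (Fin n) → Set
IsChain fs v₀ vs =
  Path fs v₀ vs ×
  (∀ w → ¬ ((w , v₀) LM.∈ fs)) ×
  (∀ w → ¬ ((lastOf v₀ vs , w) LM.∈ fs))

OnChain : ∀ {n} → Fin n → Fin n → List (Fin n) → Set
OnChain z v₀ vs = z ≡ v₀ ⊎ z LM.∈ vs

Uncritical : ∀ {n} → Graph n → Fin n → Set
Uncritical G z =
  ∀ F fs → OptimalSeq G F fs →
  ∀ v₀ vs → IsChain fs v₀ vs → OnChain z v₀ vs →
  (¬ vs ≡ []) × (z ≡ v₀ ⊎ z ≡ lastOf v₀ vs)

{-# OPTIONS --safe #-}
module Submission where

-- Take a filling forcing sequence from an optimal zero forcing set F of G. As z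
-- is uncritical, z either starts its chain (z ∈ F forces some u and is never
-- forced) or ends it (z ∉ F is forced and never forces). Removing z from F, and
-- in the first case adding u, gives a set of the same size in G ∖ z, from which
-- the forces of the sequence not involving z, minus those whose target is
-- already filled, fill G ∖ z; so Z(G ∖ z) ≤ Z(G). Conversely, a zero forcing
-- set F′ of G ∖ z with ∣F′∣ < Z(G) would make F′ ∪ {z} an optimal zero forcing
-- set of G whose lifted forcing sequence never involves z, so z would lie on a
-- chain of length 0.

open import Defs
open import Data.Bool using (true)
open import Data.Fin using (Fin; zero; suc; punchIn; _≟_)
open import Data.Fin.Properties using (punchIn-injective; punchInᵢ≢i; punchIn-punchOut)
open import Data.Fin.Subset using (Subset; _∈_; _∉_; _⊆_; _∪_; ⁅_⁆; ∣_∣; inside; outside)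
open import Data.Fin.Subset.Properties
  using (_∈?_; x∈⁅x⁆; x∈⁅y⁆⇒x≡y; x∈p∪q⁻; p⊆p∪q; q⊆p∪q; ∪-identityʳ; ⊆-refl; ⊆-reflexive)
open import Data.List using (List; []; _∷_; map; _++_)
open import Data.List.Relation.Unary.Any using (here; there)
import Data.List.Membership.Propositional as LM
open import Data.List.Membership.Propositional.Properties using (∈-map⁻; ∈-++⁺ˡ)
open import Data.Nat using (ℕ; suc; _≤_)
open import Data.Nat.Properties using (≤-antisym; ≮⇒≥)
open import Data.Product using (Σ-syntax; ∃-syntax; ∃₂; _×_; _,_; proj₁; proj₂; curry; uncurry)
open import Data.Sum using (_⊎_; inj₁; inj₂; [_,_]; map₂)
open import Data.Vec as Vec using (Vec; _∷_; lookup; insertAt; removeAt)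
open import Data.Vec.Properties
  using ([]=⇒lookup; lookup⇒[]=; insertAt-lookup; insertAt-punchIn; insertAt-removeAt; removeAt-insertAt)
open import Function using (_∘_)
open import Relation.Nullary using (¬_; yes; no; contradiction)
open import Relation.Binary.PropositionalEquality
  using (_≡_; _≢_; refl; sym; trans; cong; subst; module ≡-Reasoning)

private variable
  m n : ℕ

data PunchInView (z : Fin (suc n)) : Fin (suc n) → Set where
  pivot    : PunchInView z z
  punched : ∀ i → PunchInView z (punchIn z i)

punchInView : ∀ (z x : Fin (suc n)) → PunchInView z x
punchInView z x with x ≟ z
... | yes refl = pivot
... | no x≢z   = subst (PunchInView z) (punchIn-punchOut (x≢z ∘ sym)) (punched _)

x∈p∪⁅x⁆ : ∀ (p : Subset n) x → x ∈ p ∪ ⁅ x ⁆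
x∈p∪⁅x⁆ p x = q⊆p∪q p ⁅ x ⁆ (x∈⁅x⁆ x)

x∈p∪⁅y⁆⁻ : ∀ (p : Subset n) {x} y → x ∈ p ∪ ⁅ y ⁆ → x ∈ p ⊎ x ≡ y
x∈p∪⁅y⁆⁻ p y = map₂ (x∈⁅y⁆⇒x≡y y) ∘ x∈p∪q⁻ p ⁅ y ⁆

∈-resp-lookup : ∀ {p : Subset m} {q : Subset n} {i j} → lookup p i ≡ lookup q j → i ∈ p → j ∈ q
∈-resp-lookup {q = q} {j = j} eq i∈p = lookup⇒[]= j q (trans (sym eq) ([]=⇒lookup i∈p))

lookup-removeAt : ∀ {A : Set} (xs : Vec A (suc n)) i j →
                  lookup (removeAt xs i) j ≡ lookup xs (punchIn i j)
lookup-removeAt xs i j = begin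
  lookup (removeAt xs i) j
    ≡⟨ insertAt-punchIn (removeAt xs i) i (lookup xs i) j ⟨
  lookup (insertAt (removeAt xs i) i (lookup xs i)) (punchIn i j)
    ≡⟨ cong (λ ys → lookup ys (punchIn i j)) (insertAt-removeAt xs i) ⟩
  lookup xs (punchIn i j)
    ∎
  where open ≡-Reasoning

∈removeAt⇒punchIn∈ : ∀ (p : Subset (suc n)) z {i} → i ∈ removeAt p z → punchIn z i ∈ p
∈removeAt⇒punchIn∈ p z {i} = ∈-resp-lookup (lookup-removeAt p z i)

punchIn∈⇒∈removeAt : ∀ (p : Subset (suc n)) z {i} → punchIn z i ∈ p → i ∈ removeAt p z
punchIn∈⇒∈removeAt p z {i} = ∈-resp-lookup (sym (lookup-removeAt p z i))

removeAt-∪⁅⁆⊆ : ∀ (S : Subset (suc n)) {T} z {x} →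
                removeAt S z ⊆ T → (∀ {i} → punchIn z i ≡ x → i ∈ T) → removeAt (S ∪ ⁅ x ⁆) z ⊆ T
removeAt-∪⁅⁆⊆ S z {x} S⊆T x∈T i∈ with x∈p∪⁅y⁆⁻ S x (∈removeAt⇒punchIn∈ (S ∪ ⁅ x ⁆) z i∈)
... | inj₁ i∈S = S⊆T (punchIn∈⇒∈removeAt S z i∈S)
... | inj₂ eq  = x∈T eq

removeAt-∪⁅punchIn⁆⊆ : ∀ (S : Subset (suc n)) {T} z {x} →
                       removeAt S z ⊆ T → removeAt (S ∪ ⁅ punchIn z x ⁆) z ⊆ T ∪ ⁅ x ⁆
removeAt-∪⁅punchIn⁆⊆ S {T} z {x} S⊆T = removeAt-∪⁅⁆⊆ S z (p⊆p∪q ⁅ x ⁆ ∘ S⊆T)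
  λ eq → subst (_∈ T ∪ ⁅ x ⁆) (sym (punchIn-injective z _ x eq)) (x∈p∪⁅x⁆ T x)

⊆removeAt-∪⁅punchIn⁆ : ∀ (S : Subset (suc n)) {T} z {x} →
                       T ⊆ removeAt S z → T ∪ ⁅ x ⁆ ⊆ removeAt (S ∪ ⁅ punchIn z x ⁆) z
⊆removeAt-∪⁅punchIn⁆ S {T} z {x} T⊆S i∈ with x∈p∪⁅y⁆⁻ T x i∈
... | inj₁ i∈T  =
  punchIn∈⇒∈removeAt _ z (p⊆p∪q ⁅ punchIn z x ⁆ (∈removeAt⇒punchIn∈ S z (T⊆S i∈T)))
... | inj₂ refl = punchIn∈⇒∈removeAt _ z (x∈p∪⁅x⁆ S (punchIn z x))

∣insertAt∣ : ∀ (p : Subset n) i x → ∣ insertAt p i x ∣ ≡ ∣ x ∷ p ∣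
∣insertAt∣ p             zero    x       = refl
∣insertAt∣ (outside ∷ p) (suc i) outside = ∣insertAt∣ p i outside
∣insertAt∣ (outside ∷ p) (suc i) inside  = ∣insertAt∣ p i inside
∣insertAt∣ (inside  ∷ p) (suc i) outside = cong suc (∣insertAt∣ p i outside)
∣insertAt∣ (inside  ∷ p) (suc i) inside  = cong suc (∣insertAt∣ p i inside)

∣p∣≡∣lookup∷removeAt∣ : ∀ (p : Subset (suc n)) i → ∣ p ∣ ≡ ∣ lookup p i ∷ removeAt p i ∣
∣p∣≡∣lookup∷removeAt∣ p i =
  trans (cong ∣_∣ (sym (insertAt-removeAt p i))) (∣insertAt∣ (removeAt p i) i (lookup p i))

x∉p⇒∣removeAt∣≡∣p∣ : ∀ {p : Subset (suc n)} {x} → x ∉ p → ∣ removeAt p x ∣ ≡ ∣ p ∣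
x∉p⇒∣removeAt∣≡∣p∣ {p = p} {x} x∉p with lookup p x in eq | ∣p∣≡∣lookup∷removeAt∣ p x
... | inside  | _ = contradiction (lookup⇒[]= x p eq) x∉p
... | outside | e = sym e

x∈p⇒1+∣removeAt∣≡∣p∣ : ∀ {p : Subset (suc n)} {x} → x ∈ p → suc ∣ removeAt p x ∣ ≡ ∣ p ∣
x∈p⇒1+∣removeAt∣≡∣p∣ {p = p} {x} x∈p with lookup p x | []=⇒lookup x∈p | ∣p∣≡∣lookup∷removeAt∣ p x
... | .inside | refl | e = sym e

x∉p⇒∣p∪⁅x⁆∣≡1+∣p∣ : ∀ (p : Subset n) {x} → x ∉ p → ∣ p ∪ ⁅ x ⁆ ∣ ≡ suc ∣ p ∣
x∉p⇒∣p∪⁅x⁆∣≡1+∣p∣ (inside  ∷ p) {zero}  x∉p = contradiction Vec.here x∉p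
x∉p⇒∣p∪⁅x⁆∣≡1+∣p∣ (outside ∷ p) {zero}  _   = cong (suc ∘ ∣_∣) (∪-identityʳ p)
x∉p⇒∣p∪⁅x⁆∣≡1+∣p∣ (inside  ∷ p) {suc x} x∉p = cong suc (x∉p⇒∣p∪⁅x⁆∣≡1+∣p∣ p (x∉p ∘ Vec.there))
x∉p⇒∣p∪⁅x⁆∣≡1+∣p∣ (outside ∷ p) {suc x} x∉p = x∉p⇒∣p∪⁅x⁆∣≡1+∣p∣ p (x∉p ∘ Vec.there)

Forced : List (Force n) → Fin n → Set
Forced fs v = ∃[ w ] (w , v) LM.∈ fs

Forces : List (Force n) → Fin n → Set
Forces fs v = ∃[ u ] (v , u) LM.∈ fs

∈-after⁺ : ∀ {S : Subset n} fs {x} → x ∈ S → x ∈ after S fs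
∈-after⁺ []       x∈S = x∈S
∈-after⁺ (_ ∷ fs) x∈S = ∈-after⁺ fs (p⊆p∪q _ x∈S)

∈-after⁻ : ∀ {S : Subset n} fs {x} → x ∈ after S fs → x ∈ S ⊎ Forced fs x
∈-after⁻ []                     x∈ = inj₁ x∈
∈-after⁻ {S = S} ((v , u) ∷ fs) x∈ with ∈-after⁻ fs x∈
... | inj₂ (w , w→x) = inj₂ (w , there w→x)
... | inj₁ x∈S∪u with x∈p∪⁅y⁆⁻ S u x∈S∪u
...   | inj₁ x∈S = inj₁ x∈S
...   | inj₂ refl = inj₂ (v , here refl)

Path-weaken : ∀ {fs : List (Force n)} {f v vs} → Path fs v vs → Path (f ∷ fs) v vs
Path-weaken end             = end
Path-weaken (step v→u path) = step (there v→u) (Path-weaken path)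

Path-++ : ∀ {fs : List (Force n)} {v us vs} →
          Path fs v us → Path fs (lastOf v us) vs → Path fs v (us ++ vs)
Path-++ end             path′ = path′
Path-++ (step v→u path) path′ = step v→u (Path-++ path path′)

lastOf-++ : ∀ (v : Fin n) us vs → lastOf v (us ++ vs) ≡ lastOf (lastOf v us) vs
lastOf-++ v []       vs = refl
lastOf-++ v (u ∷ us) vs = lastOf-++ u us vs

lastOf∈ : ∀ (u : Fin n) us → lastOf u us LM.∈ u ∷ us
lastOf∈ u []        = here refl
lastOf∈ u (u′ ∷ us) = there (lastOf∈ u′ us)

OnChain-lastOf : ∀ (v : Fin n) us vs → OnChain (lastOf v us) v (us ++ vs)
OnChain-lastOf v []       vs = inj₁ refl
OnChain-lastOf v (u ∷ us) vs = inj₂ (∈-++⁺ˡ (lastOf∈ u us))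

Path-sourceForces : ∀ {fs : List (Force n)} {v vs} → Path fs v vs → vs ≢ [] → Forces fs v
Path-sourceForces end          vs≢[] = contradiction refl vs≢[]
Path-sourceForces (step v→u _) _     = _ , v→u

Path-terminalForced : ∀ {fs : List (Force n)} {v vs} → Path fs v vs → vs ≢ [] → Forced fs (lastOf v vs)
Path-terminalForced end                      vs≢[] = contradiction refl vs≢[]
Path-terminalForced (step v→u end)           _     = _ , v→u
Path-terminalForced (step _ path@(step _ _)) _     = Path-terminalForced path λ ()

module _ {G : Graph n} where

  forced⇒∉ : ∀ {S used fs w x} → ValidSeq G S used fs → (w , x) LM.∈ fs → x ∉ S
  forced⇒∉ ((_ , _ , _ , x∉S , _) ∷ _) (here refl) = x∉S
  forced⇒∉ (_ ∷ valid) (there w→x) = forced⇒∉ valid w→x ∘ p⊆p∪q _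

  used⇒¬forces : ∀ {S used fs v u} → ValidSeq G S used fs → v LM.∈ used → ¬ (v , u) LM.∈ fs
  used⇒¬forces ((_ , v∉used , _) ∷ _) v∈used (here refl) = v∉used v∈used
  used⇒¬forces (_ ∷ valid) v∈used (there v→u) = used⇒¬forces valid (there v∈used) v→u

  forces-unique : ∀ {S used fs v a b} → ValidSeq G S used fs → (v , a) LM.∈ fs → (v , b) LM.∈ fs → a ≡ b
  forces-unique (_ ∷ _)     (here refl) (here refl) = refl
  forces-unique (_ ∷ valid) (here refl) (there v→b) = contradiction v→b (used⇒¬forces valid (here refl))
  forces-unique (_ ∷ valid) (there v→a) (here refl) = contradiction v→a (used⇒¬forces valid (here refl))
  forces-unique (_ ∷ valid) (there v→a) (there v→b) = forces-unique valid v→a v→b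

  filled⇒stuck : ∀ {S} used → (∀ v → v ∈ S) → ∀ v u → ¬ ValidForce G S used v u
  filled⇒stuck _ filled _ u (_ , _ , _ , u∉S , _) = u∉S (filled u)

  ZFS⇒optimalSeq : ∀ {F} (zfs : ZeroForcingSet G F) → IsZ G ∣ F ∣ → OptimalSeq G F (proj₁ zfs)
  ZFS⇒optimalSeq zfs@(_ , valid , filled) Z = (zfs , Z) , valid , filled⇒stuck _ filled

  chainTo : ∀ {S used fs} → ValidSeq G S used fs → ∀ x →
            ∃₂ λ v₀ us → Path fs v₀ us × lastOf v₀ us ≡ x × ¬ Forced fs v₀
  chainTo [] x = x , [] , end , refl , λ ()
  chainTo {S} {fs = (a , b) ∷ fs} ((a∈S , _ , _ , b∉S , _) ∷ valid) x with chainTo valid x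
  ... | v₀ , us , path , last≡x , v₀-unforced with v₀ ≟ b
  ...   | yes refl = a , v₀ ∷ us , step (here refl) (Path-weaken path) , last≡x , a-unforced
    where
      a-unforced : ¬ Forced ((a , v₀) ∷ fs) a
      a-unforced (_ , here refl) = b∉S a∈S
      a-unforced (_ , there w→a) = forced⇒∉ valid w→a (p⊆p∪q _ a∈S)
  ...   | no v₀≢b = v₀ , us , Path-weaken path , last≡x , v₀-unforced′
    where
      v₀-unforced′ : ¬ Forced ((a , b) ∷ fs) v₀
      v₀-unforced′ (_ , here refl)  = v₀≢b refl
      v₀-unforced′ (w , there w→v₀) = v₀-unforced (w , w→v₀)

  -- The last conjunct strengthens the induction: it shows that the end of the
  -- chain is not the forcer of a force prepended to fs.
  chainFrom : ∀ {S used fs} → ValidSeq G S used fs → ∀ x →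
              ∃[ vs ] Path fs x vs × ¬ Forces fs (lastOf x vs) × (lastOf x vs ≡ x ⊎ lastOf x vs ∉ S)
  chainFrom [] x = [] , end , (λ ()) , inj₁ refl
  chainFrom {S} {fs = (a , b) ∷ fs} ((a∈S , _ , _ , b∉S , _) ∷ valid) x with x ≟ a
  ... | yes refl with chainFrom valid b
  ...   | us , path , idle , last≡b⊎∉ =
    b ∷ us , step (here refl) (Path-weaken path) , idle′ , inj₂ last∉S
    where
      last∉S : lastOf b us ∉ S
      last∉S = [ (λ last≡b → subst (_∉ S) (sym last≡b) b∉S) , _∘ p⊆p∪q _ ] last≡b⊎∉
      idle′ : ¬ Forces ((x , b) ∷ fs) (lastOf b us)
      idle′ (_ , here refl)    = last∉S a∈S
      idle′ (w , there last→w) = idle (w , last→w)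
  chainFrom {S} {fs = (a , b) ∷ fs} ((a∈S , _) ∷ valid) x | no x≢a with chainFrom valid x
  ...   | us , path , idle , last≡x⊎∉ = us , Path-weaken path , idle′ , last≡x⊎∉S
    where
      last≡x⊎∉S : lastOf x us ≡ x ⊎ lastOf x us ∉ S
      last≡x⊎∉S = map₂ (_∘ p⊆p∪q _) last≡x⊎∉
      idle′ : ¬ Forces ((a , b) ∷ fs) (lastOf x us)
      idle′ (_ , here refl) with last≡x⊎∉S
      ... | inj₁ last≡x = x≢a (sym last≡x)
      ... | inj₂ last∉S = last∉S a∈S
      idle′ (w , there last→w) = idle (w , last→w)

  chainThrough : ∀ {S used fs} → ValidSeq G S used fs → ∀ x →
                 ∃₂ λ v₀ vs → IsChain fs v₀ vs × OnChain x v₀ vs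
  chainThrough {fs = fs} valid x with chainTo valid x | chainFrom valid x
  ... | v₀ , us , path , refl , unforced | ws , path′ , idle , _ =
    v₀ , us ++ ws , (Path-++ path path′ , curry unforced , idle′) , OnChain-lastOf v₀ us ws
    where
      idle′ : ∀ w → ¬ (lastOf v₀ (us ++ ws) , w) LM.∈ fs
      idle′ rewrite lastOf-++ v₀ us ws = curry idle

  uncritical⇒source⊎terminal : ∀ {z F fs} → Uncritical G z → OptimalSeq G F fs →
                               (Forces fs z × ¬ Forced fs z) ⊎ (Forced fs z × ¬ Forces fs z)
  uncritical⇒source⊎terminal {z} unc opt@(_ , valid , _) with chainThrough valid z
  ... | v₀ , vs , chain@(path , v₀-unforced , last-idle) , z∈chain with unc _ _ opt v₀ vs chain z∈chain
  ...   | vs≢[] , inj₁ refl = inj₁ (Path-sourceForces path vs≢[] , uncurry v₀-unforced)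
  ...   | vs≢[] , inj₂ refl = inj₂ (Path-terminalForced path vs≢[] , uncurry last-idle)

module Deletion (G : Graph (suc n)) (z : Fin (suc n)) where

  data RestrictedForce (S : Subset (suc n)) (S′ : Subset n) (used′ : List (Fin n)) :
                       Fin (suc n) → Fin (suc n) → Set where
    redundant : ∀ {v x} → removeAt (S ∪ ⁅ x ⁆) z ⊆ S′ → RestrictedForce S S′ used′ v x
    restricted : ∀ {v′ x′} → ValidForce (G ∖ z) S′ used′ v′ x′ →
                 RestrictedForce S S′ used′ (punchIn z v′) (punchIn z x′)

  restrictForce : ∀ {S S′ used used′ v x} → ValidForce G S used v x → removeAt S z ⊆ S′ →
                  (∀ {v′} → v′ LM.∈ used′ → punchIn z v′ LM.∈ used) →
                  (∀ {x′} → (z , punchIn z x′) ≡ (v , x) → x′ ∈ S′) →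
                  RestrictedForce S S′ used′ v x
  restrictForce {S} {S′} {v = v} {x} (v∈S , v∉used , v~x , _ , others) S⊆ used⊆ zForce
    with punchInView z x
  ... | pivot = redundant (removeAt-∪⁅⁆⊆ S z S⊆ λ eq → contradiction eq (punchInᵢ≢i z _))
  ... | punched x′ with x′ ∈? S′
  ...   | yes x′∈S′ =
    redundant (removeAt-∪⁅⁆⊆ S z S⊆ λ eq → subst (_∈ S′) (punchIn-injective z x′ _ (sym eq)) x′∈S′)
  ...   | no x′∉S′ with punchInView z v
  ...     | pivot      = contradiction (zForce refl) x′∉S′
  ...     | punched v′ =
    restricted (S⊆ (punchIn∈⇒∈removeAt S z v∈S) , v∉used ∘ used⊆ , v~x , x′∉S′ , others′)
    where
      others′ : ∀ w′ → adj (G ∖ z) v′ w′ ≡ true → w′ ≢ x′ → w′ ∈ S′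
      others′ w′ v′~w′ w′≢x′ =
        S⊆ (punchIn∈⇒∈removeAt S z (others (punchIn z w′) v′~w′ (w′≢x′ ∘ punchIn-injective z w′ x′)))

  restrict : ∀ {S used fs} → ValidSeq G S used fs →
             ∀ {S′ used′} → removeAt S z ⊆ S′ → (∀ {v′} → v′ LM.∈ used′ → punchIn z v′ LM.∈ used) →
             (∀ {x′} → (z , punchIn z x′) LM.∈ fs → x′ ∈ S′) →
             ∃[ fs′ ] ValidSeq (G ∖ z) S′ used′ fs′ × removeAt (after S fs) z ⊆ after S′ fs′
  restrict [] S⊆ _ _ = [] , [] , S⊆
  restrict {S} (valid ∷ valids) S⊆ used⊆ zForces with restrictForce valid S⊆ used⊆ (zForces ∘ here)
  ... | redundant S∪x⊆ = restrict valids S∪x⊆ (there ∘ used⊆) (zForces ∘ there)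
  ... | restricted {v′} {x′} valid′ =
    let fs′ , valids′ , filled =
          restrict valids (removeAt-∪⁅punchIn⁆⊆ S z S⊆) used⊆′ (p⊆p∪q ⁅ x′ ⁆ ∘ zForces ∘ there)
    in (v′ , x′) ∷ fs′ , valid′ ∷ valids′ , filled
    where
      used⊆′ : ∀ {u′} → u′ LM.∈ v′ ∷ _ → punchIn z u′ LM.∈ punchIn z v′ ∷ _
      used⊆′ (here refl) = here refl
      used⊆′ (there u′∈) = there (used⊆ u′∈)

  punchInForce : Force n → Force (suc n)
  punchInForce (v′ , x′) = punchIn z v′ , punchIn z x′

  extendForce : ∀ {S S′ used′ v′ x′} → z ∈ S → S′ ⊆ removeAt S z → removeAt S z ⊆ S′ →
                ValidForce (G ∖ z) S′ used′ v′ x′ →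
                ValidForce G S (map (punchIn z) used′) (punchIn z v′) (punchIn z x′)
  extendForce {S} {used′ = used′} {v′} {x′} z∈S ⊆S S⊆ (v′∈S′ , v′∉used′ , v′~x′ , x′∉S′ , others′) =
    ∈removeAt⇒punchIn∈ S z (⊆S v′∈S′) , v∉used , v′~x′ , x′∉S′ ∘ S⊆ ∘ punchIn∈⇒∈removeAt S z , others
    where
      v∉used : ¬ punchIn z v′ LM.∈ map (punchIn z) used′
      v∉used v∈ with ∈-map⁻ (punchIn z) v∈
      ... | u′ , u′∈used′ , v≡u =
        v′∉used′ (subst (LM._∈ used′) (sym (punchIn-injective z v′ u′ v≡u)) u′∈used′)
      others : ∀ w → adj G (punchIn z v′) w ≡ true → w ≢ punchIn z x′ → w ∈ S
      others w v~w w≢x with punchInView z w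
      ... | pivot      = z∈S
      ... | punched w′ = ∈removeAt⇒punchIn∈ S z (⊆S (others′ w′ v~w (w≢x ∘ cong (punchIn z))))

  extend : ∀ {S S′ used′ fs′} → ValidSeq (G ∖ z) S′ used′ fs′ →
           z ∈ S → S′ ⊆ removeAt S z → removeAt S z ⊆ S′ →
           ValidSeq G S (map (punchIn z) used′) (map punchInForce fs′) ×
           after S′ fs′ ⊆ removeAt (after S (map punchInForce fs′)) z
  extend [] _ ⊆S _ = [] , ⊆S
  extend {S} (valid′ ∷ valids′) z∈S ⊆S S⊆ =
    let valids , filled =
          extend valids′ (p⊆p∪q _ z∈S) (⊆removeAt-∪⁅punchIn⁆ S z ⊆S) (removeAt-∪⁅punchIn⁆⊆ S z S⊆)
    in extendForce z∈S ⊆S S⊆ valid′ ∷ valids , filled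

  punchInForces-¬forced : ∀ fs′ → ¬ Forced (map punchInForce fs′) z
  punchInForces-¬forced fs′ (_ , w→z) with ∈-map⁻ punchInForce w→z
  ... | (_ , x′) , _ , eq = punchInᵢ≢i z x′ (sym (cong proj₂ eq))

  punchInForces-¬forces : ∀ fs′ → ¬ Forces (map punchInForce fs′) z
  punchInForces-¬forces fs′ (_ , z→u) with ∈-map⁻ punchInForce z→u
  ... | (v′ , _) , _ , eq = punchInᵢ≢i z v′ (sym (cong proj₁ eq))

  restrictZFS : ∀ {F fs F′} → ValidSeq G F [] fs → (∀ v → v ∈ after F fs) → removeAt F z ⊆ F′ →
                (∀ {x′} → (z , punchIn z x′) LM.∈ fs → x′ ∈ F′) → ZeroForcingSet (G ∖ z) F′
  restrictZFS {F} {fs} valid filled F⊆ zForces =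
    let fs′ , valid′ , filled⊆ = restrict valid F⊆ (λ ()) zForces
    in fs′ , valid′ , λ i → filled⊆ (punchIn∈⇒∈removeAt (after F fs) z (filled (punchIn z i)))

  restrictZFS-terminal : ∀ {F fs} → ValidSeq G F [] fs → (∀ v → v ∈ after F fs) →
                         Forced fs z → ¬ Forces fs z →
                         ∃[ F′ ] ZeroForcingSet (G ∖ z) F′ × ∣ F′ ∣ ≡ ∣ F ∣
  restrictZFS-terminal {F} valid filled (_ , w→z) idle =
    removeAt F z ,
    restrictZFS valid filled ⊆-refl (λ z→x → contradiction (_ , z→x) idle) ,
    x∉p⇒∣removeAt∣≡∣p∣ (forced⇒∉ valid w→z)

  restrictZFS-source : ∀ {F fs} → ValidSeq G F [] fs → (∀ v → v ∈ after F fs) →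
                       Forces fs z → ¬ Forced fs z →
                       ∃[ F′ ] ZeroForcingSet (G ∖ z) F′ × ∣ F′ ∣ ≡ ∣ F ∣
  restrictZFS-source {F} {fs} valid filled (u , z→u) unforced with punchInView z u
  ... | pivot      = contradiction (z , z→u) unforced
  ... | punched u′ = removeAt F z ∪ ⁅ u′ ⁆ , restrictZFS valid filled (p⊆p∪q ⁅ u′ ⁆) zForces , size
    where
      zForces : ∀ {x′} → (z , punchIn z x′) LM.∈ fs → x′ ∈ removeAt F z ∪ ⁅ u′ ⁆
      zForces z→x = subst (_∈ removeAt F z ∪ ⁅ u′ ⁆)
                          (punchIn-injective z u′ _ (forces-unique valid z→u z→x))
                          (x∈p∪⁅x⁆ (removeAt F z) u′)
      z∈F : z ∈ F
      z∈F = [ (λ z∈F → z∈F) , (λ z-forced → contradiction z-forced unforced) ] (∈-after⁻ fs (filled z))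
      size : ∣ removeAt F z ∪ ⁅ u′ ⁆ ∣ ≡ ∣ F ∣
      size = begin
        ∣ removeAt F z ∪ ⁅ u′ ⁆ ∣ ≡⟨ x∉p⇒∣p∪⁅x⁆∣≡1+∣p∣ _ (forced⇒∉ valid z→u ∘ ∈removeAt⇒punchIn∈ F z) ⟩
        suc ∣ removeAt F z ∣      ≡⟨ x∈p⇒1+∣removeAt∣≡∣p∣ z∈F ⟩
        ∣ F ∣                     ∎
        where open ≡-Reasoning

  extendZFS : ∀ {F′} → ZeroForcingSet (G ∖ z) F′ →
              Σ[ zfs ∈ ZeroForcingSet G (insertAt F′ z inside) ]
                ¬ Forced (proj₁ zfs) z × ¬ Forces (proj₁ zfs) z
  extendZFS {F′} (fs′ , valid′ , filled′) =
    (fs , proj₁ extended , filled) , punchInForces-¬forced fs′ , punchInForces-¬forces fs′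
    where
      F : Subset (suc n)
      F = insertAt F′ z inside
      fs : List (Force (suc n))
      fs = map punchInForce fs′
      z∈F : z ∈ F
      z∈F = lookup⇒[]= z F (insertAt-lookup F′ z inside)
      F′≡F-z : F′ ≡ removeAt F z
      F′≡F-z = sym (removeAt-insertAt F′ z inside)
      extended : ValidSeq G F [] fs × after F′ fs′ ⊆ removeAt (after F fs) z
      extended = extend valid′ z∈F (⊆-reflexive F′≡F-z) (⊆-reflexive (sym F′≡F-z))
      filled : ∀ v → v ∈ after F fs
      filled v with punchInView z v
      ... | pivot      = ∈-after⁺ fs z∈F
      ... | punched v′ = ∈removeAt⇒punchIn∈ (after F fs) z (proj₂ extended (filled′ v′))

  restrictOptimalZFS : Uncritical G z → ∀ {F} → ZeroForcingSet G F → IsZ G ∣ F ∣ →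
                       ∃[ F′ ] ZeroForcingSet (G ∖ z) F′ × ∣ F′ ∣ ≡ ∣ F ∣
  restrictOptimalZFS unc zfs@(_ , valid , filled) Z
    with uncritical⇒source⊎terminal unc (ZFS⇒optimalSeq zfs Z)
  ... | inj₁ (forces , unforced) = restrictZFS-source valid filled forces unforced
  ... | inj₂ (forced , idle)     = restrictZFS-terminal valid filled forced idle

  Z≤∣ZFS∖z∣ : Uncritical G z → ∀ {k} → IsZ G k → ∀ F′ → ZeroForcingSet (G ∖ z) F′ → k ≤ ∣ F′ ∣
  Z≤∣ZFS∖z∣ unc {k} Z@(_ , minimal) F′ zfs′ = ≮⇒≥ λ ∣F′∣<k →
    let zfs , unforced , idle = extendZFS zfs′
        ∣F∣≡k = ≤-antisym (subst (_≤ k) (sym (∣insertAt∣ F′ z inside)) ∣F′∣<k) (minimal _ zfs)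
    in [ idle ∘ proj₁ , unforced ∘ proj₁ ]
         (uncritical⇒source⊎terminal unc (ZFS⇒optimalSeq zfs (subst (IsZ G) (sym ∣F∣≡k) Z)))

proposition5p4 : ∀ {n} (G : Graph (suc n)) (z : Fin (suc n)) →
    Uncritical G z → ∀ (k : ℕ) → IsZ G k → IsZ (G ∖ z) k
proposition5p4 G z unc k Z@((_ , zfs , refl) , _) = restrictOptimalZFS unc zfs Z , Z≤∣ZFS∖z∣ unc Z
  where open Deletion G z
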